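{- Let $n\ge 3$ and $1\le a,r\le n-1$ be integers with $r^2\equiv 1\pmod n$ and $ra\equiv \pm a\pmod n$. Then the rose window graph $R_n(a,r)$ is a Cayley graph.
   Context: For integers $n\ge 3$ and $1\le a,r\le n-1$, the rose window graph $R_n(a,r)$ has vertex set $\{A_i,B_i : i\in\mathbb{Z}_n\}$ and edges $A_iA_{i+1}$, $A_iB_i$, $A_{i+a}B_i$ and $B_iB_{i+r}$, indices taken modulo $n$. A graph is Cayley iff its automorphism group has a subgroup acting regularly on its vertices. -}

module Defs where

open import Level using (Level; 0ℓ) renaming (suc to lsuc)
open import Data.Nat using (ℕ; _+_; _*_; _%_; NonZero)
open import Data.Fin using (Fin; toℕ)
open import Data.Sum using (_⊎_)
open import Data.Product using (Σ; _×_)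
open import Function using (_∘_; id)
open import Relation.Binary.PropositionalEquality using (_≡_)

data RVertex (n : ℕ) : Set where
  A : Fin n → RVertex n
  B : Fin n → RVertex n

data REdge (n a r : ℕ) .{{_ : NonZero n}} : RVertex n → RVertex n → Set where
  rim   : (i j : Fin n) → toℕ j ≡ (toℕ i + 1) % n → REdge n a r (A i) (A j)
  spoke : (i : Fin n) → REdge n a r (A i) (B i)
  hub   : (i j : Fin n) → toℕ j ≡ (toℕ i + a) % n → REdge n a r (A j) (B i)
  inner : (i j : Fin n) → toℕ j ≡ (toℕ i + r) % n → REdge n a r (B i) (B j)

RAdj : (n a r : ℕ) .{{_ : NonZero n}} → RVertex n → RVertex n → Set
RAdj n a r u v = REdge n a r u v ⊎ REdge n a r v u

record Automorphism {V : Set} (Adj : V → V → Set) : Set where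
  field
    fun      : V → V
    inv      : V → V
    inv-left  : ∀ x → inv (fun x) ≡ x
    inv-right : ∀ x → fun (inv x) ≡ x
    preserves : ∀ u v → Adj u v → Adj (fun u) (fun v)
    reflects  : ∀ u v → Adj (fun u) (fun v) → Adj u v
open Automorphism public

record IsSubgroup {V : Set} {Adj : V → V → Set}
                  (G : Automorphism Adj → Set) : Set₁ where
  field
    has-id  : Σ (Automorphism Adj) λ e → G e × (∀ x → fun e x ≡ x)
    has-comp : ∀ g h → G g → G h →
               Σ (Automorphism Adj) λ k → G k × (∀ x → fun k x ≡ fun g (fun h x))
    has-inv  : ∀ g → G g →
               Σ (Automorphism Adj) λ k → G k × (∀ x → fun k x ≡ inv g x)

IsRegular : {V : Set} {Adj : V → V → Set} → (Automorphism Adj → Set) → Set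
IsRegular {V} {Adj} G =
  (∀ u v → Σ (Automorphism Adj) λ g → G g × (fun g u ≡ v)) ×
  (∀ u v (g h : Automorphism Adj) → G g → G h → fun g u ≡ v → fun h u ≡ v →
     ∀ x → fun g x ≡ fun h x)

IsCayley : {V : Set} (Adj : V → V → Set) → Set₁
IsCayley Adj = Σ (Automorphism Adj → Set) λ G → IsSubgroup G × IsRegular G

-- Let d = a if r a ≡ a and d = 0 if r a ≡ - a (mod n).  The rotations A_i ↦ A_{i+k}, B_i ↦ B_{i+k}
-- and the twists A_i ↦ B_{r i + k}, B_i ↦ A_{r i + k + d} are automorphisms of R_n(a,r): a twist
-- exchanges rim and inner edges because r² ≡ 1, and it exchanges spokes with hubs when d = a and
-- preserves both classes when d = 0.  Since r d ≡ d these 2n maps are closed under composition and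
-- inverses, and exactly one of them sends a given vertex to a given vertex.

module Submission where

open import Defs
open import Level using (0ℓ)
open import Data.Nat using (ℕ; _+_; _*_; _%_; _∸_; _≤_; _<_; NonZero; >-nonZero⁻¹)
open import Data.Nat.Properties using (+-commutativeSemigroup; +-assoc; +-comm; +-identityʳ; *-identityˡ; *-identityʳ; *-distribˡ-+; *-zeroʳ; m∸n+n≡m; <⇒≤)
open import Algebra.Properties.CommutativeSemigroup +-commutativeSemigroup using (x∙yz≈y∙xz; xy∙z≈xz∙y)
open import Data.Nat.DivMod using (_mod_; m%n%n≡m%n; %-distribˡ-+; %-distribˡ-*; m%n<n; n%n≡0; m<n⇒m%n≡m)
open import Data.Nat.Tactic.RingSolver using (solve)
open import Data.List using ([]; _∷_)
open import Data.Fin using (Fin; toℕ)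
open import Data.Fin.Properties using (toℕ-fromℕ<; toℕ-injective; toℕ<n)
open import Data.Empty using (⊥)
open import Data.Product using (Σ; _×_; _,_)
open import Data.Sum using (_⊎_; inj₁; inj₂; swap)
open import Relation.Binary.Bundles using (Setoid)
open import Relation.Binary.PropositionalEquality using (_≡_; refl; sym; trans; cong; cong₂; subst; subst₂; module ≡-Reasoning)
import Relation.Binary.Reasoning.Setoid as SetoidReasoning

module Modular (n : ℕ) .{{_ : NonZero n}} where

  -- A record rather than a function of x % n, so that x and y can be inferred from a proof.
  infix 4 _≈_
  record _≈_ (x y : ℕ) : Set where
    constructor mod-eq
    field %-≡ : x % n ≡ y % n
  open _≈_ public

  ≈-refl : ∀ {x} → x ≈ x
  ≈-refl = mod-eq refl

  ≈-sym : ∀ {x y} → x ≈ y → y ≈ x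
  ≈-sym (mod-eq p) = mod-eq (sym p)

  ≈-trans : ∀ {x y z} → x ≈ y → y ≈ z → x ≈ z
  ≈-trans (mod-eq p) (mod-eq q) = mod-eq (trans p q)

  ≈-setoid : Setoid 0ℓ 0ℓ
  ≈-setoid = record
    { Carrier = ℕ ; _≈_ = _≈_
    ; isEquivalence = record { refl = ≈-refl ; sym = ≈-sym ; trans = ≈-trans } }

  ≡⇒≈ : ∀ {x y} → x ≡ y → x ≈ y
  ≡⇒≈ refl = ≈-refl

  +-cong : ∀ {x x′ y y′} → x ≈ x′ → y ≈ y′ → x + y ≈ x′ + y′
  +-cong {x} {x′} {y} {y′} (mod-eq p) (mod-eq q) = mod-eq (begin
    (x + y) % n             ≡⟨ %-distribˡ-+ x y n ⟩
    (x % n + y % n) % n     ≡⟨ cong₂ (λ u v → (u + v) % n) p q ⟩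
    (x′ % n + y′ % n) % n   ≡⟨ %-distribˡ-+ x′ y′ n ⟨
    (x′ + y′) % n           ∎)
    where open ≡-Reasoning

  *-cong : ∀ {x x′ y y′} → x ≈ x′ → y ≈ y′ → x * y ≈ x′ * y′
  *-cong {x} {x′} {y} {y′} (mod-eq p) (mod-eq q) = mod-eq (begin
    (x * y) % n             ≡⟨ %-distribˡ-* x y n ⟩
    (x % n * (y % n)) % n   ≡⟨ cong₂ (λ u v → (u * v) % n) p q ⟩
    (x′ % n * (y′ % n)) % n ≡⟨ %-distribˡ-* x′ y′ n ⟨
    (x′ * y′) % n           ∎)
    where open ≡-Reasoning

  +-congˡ : ∀ x {y y′} → y ≈ y′ → x + y ≈ x + y′
  +-congˡ x = +-cong (≈-refl {x})

  +-congʳ : ∀ y {x x′} → x ≈ x′ → x + y ≈ x′ + y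
  +-congʳ y p = +-cong p (≈-refl {y})

  *-congˡ : ∀ x {y y′} → y ≈ y′ → x * y ≈ x * y′
  *-congˡ x = *-cong (≈-refl {x})

  %-≈ : ∀ x → x % n ≈ x
  %-≈ x = mod-eq (m%n%n≡m%n x n)

  0%n≡0 : 0 % n ≡ 0
  0%n≡0 = m<n⇒m%n≡m (>-nonZero⁻¹ n)

  -_ : ℕ → ℕ
  - x = n ∸ x % n

  n≈0 : n ≈ 0
  n≈0 = mod-eq (trans (n%n≡0 n) (sym 0%n≡0))

  -‿inverseˡ : ∀ x → - x + x ≈ 0
  -‿inverseˡ x = begin
    - x + x             ≈⟨ +-congˡ (- x) (%-≈ x) ⟨
    n ∸ x % n + x % n   ≡⟨ m∸n+n≡m (<⇒≤ (m%n<n x n)) ⟩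
    n                   ≈⟨ n≈0 ⟩
    0                   ∎
    where open SetoidReasoning ≈-setoid

  -‿inverseʳ : ∀ x → x + - x ≈ 0
  -‿inverseʳ x = ≈-trans (≡⇒≈ (+-comm x (- x))) (-‿inverseˡ x)

  x+[y-x]≈y : ∀ x y → x + (y + - x) ≈ y
  x+[y-x]≈y x y = begin
    x + (y + - x)   ≡⟨ x∙yz≈y∙xz x y (- x) ⟩
    y + (x + - x)   ≈⟨ +-congˡ y (-‿inverseʳ x) ⟩
    y + 0           ≡⟨ +-identityʳ y ⟩
    y               ∎
    where open SetoidReasoning ≈-setoid

  +-cancelˡ : ∀ x {y z} → x + y ≈ x + z → y ≈ z
  +-cancelˡ x {y} {z} p = begin
    y               ≈⟨ +-congʳ y (-‿inverseˡ x) ⟨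
    - x + x + y     ≡⟨ +-assoc (- x) x y ⟩
    - x + (x + y)   ≈⟨ +-congˡ (- x) p ⟩
    - x + (x + z)   ≡⟨ +-assoc (- x) x z ⟨
    - x + x + z     ≈⟨ +-congʳ z (-‿inverseˡ x) ⟩
    z               ∎
    where open SetoidReasoning ≈-setoid

  +-cancelʳ : ∀ x {y z} → y + x ≈ z + x → y ≈ z
  +-cancelʳ x {y} {z} p = +-cancelˡ x (≈-trans (≡⇒≈ (+-comm x y)) (≈-trans p (≡⇒≈ (+-comm z x))))

  ≡%⇒≈ : ∀ {m x} → m ≡ x % n → m ≈ x
  ≡%⇒≈ {m} {x} refl = %-≈ x

  toℕ-mod : ∀ x → toℕ (x mod n) ≈ x
  toℕ-mod x = ≡%⇒≈ (toℕ-fromℕ< (m%n<n x n))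

  toℕ-≈-injective : ∀ {i j : Fin n} → toℕ i ≈ toℕ j → i ≡ j
  toℕ-≈-injective {i} {j} (mod-eq p) =
    toℕ-injective (trans (sym (m<n⇒m%n≡m (toℕ<n i))) (trans p (m<n⇒m%n≡m (toℕ<n j))))

  mod-cong : ∀ {x y} → x ≈ y → x mod n ≡ y mod n
  mod-cong {x} {y} p = toℕ-≈-injective (≈-trans (toℕ-mod x) (≈-trans p (≈-sym (toℕ-mod y))))

  mod-injective : ∀ {x y} → x mod n ≡ y mod n → x ≈ y
  mod-injective {x} {y} p = ≈-trans (≈-sym (toℕ-mod x)) (≈-trans (≡⇒≈ (cong toℕ p)) (toℕ-mod y))

  toℕ-mod-toℕ : ∀ (i : Fin n) → toℕ i mod n ≡ i
  toℕ-mod-toℕ i = toℕ-≈-injective (toℕ-mod (toℕ i))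

  ≈⇒≡% : ∀ {i : Fin n} {x} → toℕ i ≈ x → toℕ i ≡ x % n
  ≈⇒≡% {i} (mod-eq p) = trans (sym (m<n⇒m%n≡m (toℕ<n i))) p

module RoseWindow (n a r d : ℕ) .{{_ : NonZero n}} where
  open Modular n
  open SetoidReasoning ≈-setoid

  A′ B′ : ℕ → RVertex n
  A′ x = A (x mod n)
  B′ x = B (x mod n)

  A′-cong : ∀ {x y} → x ≈ y → A′ x ≡ A′ y
  A′-cong p = cong A (mod-cong p)

  B′-cong : ∀ {x y} → x ≈ y → B′ x ≡ B′ y
  B′-cong p = cong B (mod-cong p)

  A′-toℕ : ∀ {x} i → x ≈ toℕ i → A′ x ≡ A i
  A′-toℕ i p = trans (A′-cong p) (cong A (toℕ-mod-toℕ i))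

  B′-toℕ : ∀ {x} i → x ≈ toℕ i → B′ x ≡ B i
  B′-toℕ i p = trans (B′-cong p) (cong B (toℕ-mod-toℕ i))

  index : RVertex n → Fin n
  index (A i) = i
  index (B i) = i

  edge-index : ∀ {x y} c → y ≈ x + c → toℕ (y mod n) ≡ (toℕ (x mod n) + c) % n
  edge-index {x} {y} c p = ≈⇒≡% (begin
    toℕ (y mod n)       ≈⟨ toℕ-mod y ⟩
    y                   ≈⟨ p ⟩
    x + c               ≈⟨ +-congʳ c (toℕ-mod x) ⟨
    toℕ (x mod n) + c   ∎)

  rim′ : ∀ {x y} → y ≈ x + 1 → REdge n a r (A′ x) (A′ y)
  rim′ p = rim _ _ (edge-index 1 p)

  spoke′ : ∀ {x y} → x ≈ y → REdge n a r (A′ x) (B′ y)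
  spoke′ {x} p = subst (λ j → REdge n a r (A′ x) (B j)) (mod-cong p) (spoke _)

  hub′ : ∀ {x y} → y ≈ x + a → REdge n a r (A′ y) (B′ x)
  hub′ p = hub _ _ (edge-index a p)

  inner′ : ∀ {x y} → y ≈ x + r → REdge n a r (B′ x) (B′ y)
  inner′ p = inner _ _ (edge-index r p)

  data Word : Set where
    rotate twist : ℕ → Word

  infix 4 _≃_
  _≃_ : Word → Word → Set
  rotate k ≃ rotate k′ = k ≈ k′
  twist k  ≃ twist k′  = k ≈ k′
  _        ≃ _         = ⊥

  ≃-refl : ∀ w → w ≃ w
  ≃-refl (rotate _) = ≈-refl
  ≃-refl (twist _)  = ≈-refl

  actA actB : Word → ℕ → RVertex n
  actA (rotate k) x = A′ (x + k)
  actA (twist k)  x = B′ (r * x + k)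
  actB (rotate k) x = B′ (x + k)
  actB (twist k)  x = A′ (r * x + k + d)

  act : Word → RVertex n → RVertex n
  act w (A i) = actA w (toℕ i)
  act w (B i) = actB w (toℕ i)

  actA-cong : ∀ {w w′ x y} → w ≃ w′ → x ≈ y → actA w x ≡ actA w′ y
  actA-cong {rotate _} {rotate _} p q = A′-cong (+-cong q p)
  actA-cong {twist _}  {twist _}  p q = B′-cong (+-cong (*-congˡ r q) p)
  actA-cong {rotate _} {twist _}  () _
  actA-cong {twist _}  {rotate _} () _

  actB-cong : ∀ {w w′ x y} → w ≃ w′ → x ≈ y → actB w x ≡ actB w′ y
  actB-cong {rotate _} {rotate _} p q = B′-cong (+-cong q p)
  actB-cong {twist _}  {twist _}  p q = A′-cong (+-congʳ d (+-cong (*-congˡ r q) p))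
  actB-cong {rotate _} {twist _}  () _
  actB-cong {twist _}  {rotate _} () _

  act-cong : ∀ {w w′} → w ≃ w′ → ∀ v → act w v ≡ act w′ v
  act-cong p (A i) = actA-cong p ≈-refl
  act-cong p (B i) = actB-cong p ≈-refl

  act-A′ : ∀ w x → act w (A′ x) ≡ actA w x
  act-A′ w x = actA-cong (≃-refl w) (toℕ-mod x)

  act-B′ : ∀ w x → act w (B′ x) ≡ actB w x
  act-B′ w x = actB-cong (≃-refl w) (toℕ-mod x)

  infixl 7 _·_
  _·_ : Word → Word → Word
  rotate j · rotate k = rotate (k + j)
  rotate j · twist k  = twist (k + j)
  twist j  · rotate k = twist (r * k + j)
  twist j  · twist k  = rotate (r * k + d + j)

  infix 8 _⁻¹
  _⁻¹ : Word → Word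
  rotate k ⁻¹ = rotate (- k)
  twist k ⁻¹  = twist (- (r * k + d))

  act-rotate-0 : ∀ v → act (rotate 0) v ≡ v
  act-rotate-0 (A i) = A′-toℕ i (≡⇒≈ (+-identityʳ (toℕ i)))
  act-rotate-0 (B i) = B′-toℕ i (≡⇒≈ (+-identityʳ (toℕ i)))

  act-transitive : ∀ u v → Σ Word λ w → act w u ≡ v
  act-transitive (A i) (A j) = rotate (toℕ j + - toℕ i) , A′-toℕ j (x+[y-x]≈y (toℕ i) (toℕ j))
  act-transitive (B i) (B j) = rotate (toℕ j + - toℕ i) , B′-toℕ j (x+[y-x]≈y (toℕ i) (toℕ j))
  act-transitive (A i) (B j) = twist (toℕ j + - x) , B′-toℕ j (x+[y-x]≈y x (toℕ j))
    where
    x : ℕ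
    x = r * toℕ i
  act-transitive (B i) (A j) = twist (toℕ j + - x) ,
    A′-toℕ j (≈-trans (≡⇒≈ (xy∙z≈xz∙y (r * toℕ i) (toℕ j + - x) d)) (x+[y-x]≈y x (toℕ j)))
    where
    x : ℕ
    x = r * toℕ i + d

  act-free : ∀ w w′ u → act w u ≡ act w′ u → w ≃ w′
  act-free (rotate k) (rotate k′) (A i) p = +-cancelˡ (toℕ i) (mod-injective (cong index p))
  act-free (rotate k) (rotate k′) (B i) p = +-cancelˡ (toℕ i) (mod-injective (cong index p))
  act-free (twist k)  (twist k′)  (A i) p = +-cancelˡ (r * toℕ i) (mod-injective (cong index p))
  act-free (twist k)  (twist k′)  (B i) p =
    +-cancelˡ (r * toℕ i) (+-cancelʳ d (mod-injective (cong index p)))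
  act-free (rotate _) (twist _)   (A _) ()
  act-free (rotate _) (twist _)   (B _) ()
  act-free (twist _)  (rotate _)  (A _) ()
  act-free (twist _)  (rotate _)  (B _) ()

  module _ (r²≈1 : r * r ≈ 1) (rd≈d : r * d ≈ d) where

    twist²-A : ∀ x j k → r * (r * x + k) + j + d ≈ x + (r * k + d + j)
    twist²-A x j k = begin
      r * (r * x + k) + j + d       ≡⟨ solve (r ∷ x ∷ j ∷ k ∷ d ∷ []) ⟩
      r * r * x + (r * k + d + j)   ≈⟨ +-congʳ (r * k + d + j) (*-cong r²≈1 ≈-refl) ⟩
      1 * x + (r * k + d + j)       ≡⟨ cong (_+ (r * k + d + j)) (*-identityˡ x) ⟩
      x + (r * k + d + j)           ∎

    twist²-B : ∀ x j k → r * (r * x + k + d) + j ≈ x + (r * k + d + j)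
    twist²-B x j k = begin
      r * (r * x + k + d) + j           ≡⟨ solve (r ∷ x ∷ j ∷ k ∷ d ∷ []) ⟩
      r * r * x + r * d + (r * k + j)   ≈⟨ +-congʳ (r * k + j) (+-cong (*-cong r²≈1 ≈-refl) rd≈d) ⟩
      1 * x + d + (r * k + j)           ≡⟨ solve (r ∷ x ∷ j ∷ k ∷ d ∷ []) ⟩
      x + (r * k + d + j)               ∎

    actA-· : ∀ w w′ x → act w (actA w′ x) ≡ actA (w · w′) x
    actA-· (rotate j) (rotate k) x = trans (act-A′ _ _) (cong A′ (+-assoc x k j))
    actA-· (rotate j) (twist k)  x = trans (act-B′ _ _) (cong B′ (+-assoc (r * x) k j))
    actA-· (twist j)  (rotate k) x =
      trans (act-A′ _ _) (cong B′ (solve (r ∷ x ∷ j ∷ k ∷ [])))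
    actA-· (twist j)  (twist k)  x = trans (act-B′ _ _) (A′-cong (twist²-A x j k))

    actB-· : ∀ w w′ x → act w (actB w′ x) ≡ actB (w · w′) x
    actB-· (rotate j) (rotate k) x = trans (act-B′ _ _) (cong B′ (+-assoc x k j))
    actB-· (rotate j) (twist k)  x =
      trans (act-A′ _ _) (cong A′ (solve (r ∷ x ∷ j ∷ k ∷ d ∷ [])))
    actB-· (twist j)  (rotate k) x =
      trans (act-B′ _ _) (cong A′ (solve (r ∷ x ∷ j ∷ k ∷ d ∷ [])))
    actB-· (twist j)  (twist k)  x = trans (act-A′ _ _) (B′-cong (twist²-B x j k))

    act-· : ∀ w w′ v → act w (act w′ v) ≡ act (w · w′) v
    act-· w w′ (A i) = actA-· w w′ (toℕ i)
    act-· w w′ (B i) = actB-· w w′ (toℕ i)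

    ·-inverseˡ : ∀ w → w ⁻¹ · w ≃ rotate 0
    ·-inverseˡ (rotate k) = -‿inverseʳ k
    ·-inverseˡ (twist k)  = -‿inverseʳ (r * k + d)

    ·-inverseʳ : ∀ w → w · w ⁻¹ ≃ rotate 0
    ·-inverseʳ (rotate k) = -‿inverseˡ k
    ·-inverseʳ (twist k)  = begin
      r * - y + d + k     ≡⟨ +-assoc (r * - y) d k ⟩
      r * - y + (d + k)   ≈⟨ +-congˡ (r * - y) r*y≈d+k ⟨
      r * - y + r * y     ≡⟨ *-distribˡ-+ r (- y) y ⟨
      r * (- y + y)       ≈⟨ *-congˡ r (-‿inverseˡ y) ⟩
      r * 0               ≡⟨ *-zeroʳ r ⟩
      0                   ∎
      where
      y : ℕ
      y = r * k + d
      r*y≈d+k : r * y ≈ d + k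
      r*y≈d+k = begin
        r * (r * k + d)     ≡⟨ solve (r ∷ k ∷ d ∷ []) ⟩
        r * d + r * r * k   ≈⟨ +-cong rd≈d (*-cong r²≈1 ≈-refl) ⟩
        d + 1 * k           ≡⟨ cong (d +_) (*-identityˡ k) ⟩
        d + k               ∎

    act-identity : ∀ {w} → w ≃ rotate 0 → ∀ v → act w v ≡ v
    act-identity p v = trans (act-cong p v) (act-rotate-0 v)

    act-inverseˡ : ∀ w v → act (w ⁻¹) (act w v) ≡ v
    act-inverseˡ w v = trans (act-· (w ⁻¹) w v) (act-identity (·-inverseˡ w) v)

    act-inverseʳ : ∀ w v → act w (act (w ⁻¹) v) ≡ v
    act-inverseʳ w v = trans (act-· w (w ⁻¹) v) (act-identity (·-inverseʳ w) v)

  rotate-shift : ∀ {x y} c k → y ≈ x + c → y + k ≈ x + k + c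
  rotate-shift {x} {y} c k p = begin
    y + k         ≈⟨ +-congʳ k p ⟩
    x + c + k     ≡⟨ xy∙z≈xz∙y x c k ⟩
    x + k + c     ∎

  twist-shift : ∀ {x y} c k → y ≈ x + c → r * y + k ≈ r * x + k + r * c
  twist-shift {x} {y} c k p = begin
    r * y + k             ≈⟨ +-congʳ k (*-congˡ r p) ⟩
    r * (x + c) + k       ≡⟨ solve (r ∷ x ∷ c ∷ k ∷ []) ⟩
    r * x + k + r * c     ∎

  twist-rim : ∀ {x y} k → y ≈ x + 1 → r * y + k ≈ r * x + k + r
  twist-rim {x} k p = ≈-trans (twist-shift 1 k p) (≡⇒≈ (cong (r * x + k +_) (*-identityʳ r)))

  TwistOffset : Set
  TwistOffset = (d ≈ a × r * a ≈ a) ⊎ (d ≈ 0 × r * a + a ≈ 0)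

  twistOffset⇒rd≈d : TwistOffset → r * d ≈ d
  twistOffset⇒rd≈d (inj₁ (d≈a , ra≈a)) = ≈-trans (*-congˡ r d≈a) (≈-trans ra≈a (≈-sym d≈a))
  twistOffset⇒rd≈d (inj₂ (d≈0 , _))    = ≈-trans (*-congˡ r d≈0) (≈-trans (≡⇒≈ (*-zeroʳ r)) (≈-sym d≈0))

  twist-spoke : TwistOffset → ∀ y → RAdj n a r (B′ y) (A′ (y + d))
  twist-spoke (inj₁ (d≈a , _)) y = inj₂ (hub′ (+-congˡ y d≈a))
  twist-spoke (inj₂ (d≈0 , _)) y = inj₂ (spoke′ (≈-trans (+-congˡ y d≈0) (≡⇒≈ (+-identityʳ y))))

  twist-hub : TwistOffset → ∀ {y z} → z ≈ y + r * a → RAdj n a r (B′ z) (A′ (y + d))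
  twist-hub (inj₁ (d≈a , ra≈a)) {y} {z} p = inj₂ (spoke′ (begin
    y + d       ≈⟨ +-congˡ y d≈a ⟩
    y + a       ≈⟨ +-congˡ y ra≈a ⟨
    y + r * a   ≈⟨ p ⟨
    z           ∎))
  twist-hub (inj₂ (d≈0 , ra+a≈0)) {y} {z} p = inj₂ (hub′ (begin
    y + d               ≈⟨ +-congˡ y d≈0 ⟩
    y + 0               ≈⟨ +-congˡ y ra+a≈0 ⟨
    y + (r * a + a)     ≡⟨ +-assoc y (r * a) a ⟨
    y + r * a + a       ≈⟨ +-congʳ a p ⟨
    z + a               ∎))

  module _ (r²≈1 : r * r ≈ 1) (offset : TwistOffset) where

    twist-inner : ∀ {x y} k → y ≈ x + r → r * y + k + d ≈ r * x + k + d + 1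
    twist-inner {x} {y} k p = begin
      r * y + k + d             ≈⟨ +-congʳ d (twist-shift r k p) ⟩
      r * x + k + r * r + d     ≡⟨ solve (r ∷ x ∷ k ∷ d ∷ []) ⟩
      r * x + k + d + r * r     ≈⟨ +-congˡ (r * x + k + d) r²≈1 ⟩
      r * x + k + d + 1         ∎

    act-edge : ∀ w {u v} → REdge n a r u v → RAdj n a r (act w u) (act w v)
    act-edge (rotate k) (rim i j p)   = inj₁ (rim′ (rotate-shift 1 k (≡%⇒≈ p)))
    act-edge (rotate k) (spoke i)     = inj₁ (spoke′ ≈-refl)
    act-edge (rotate k) (hub i j p)   = inj₁ (hub′ (rotate-shift a k (≡%⇒≈ p)))
    act-edge (rotate k) (inner i j p) = inj₁ (inner′ (rotate-shift r k (≡%⇒≈ p)))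
    act-edge (twist k)  (rim i j p)   = inj₁ (inner′ (twist-rim k (≡%⇒≈ p)))
    act-edge (twist k)  (spoke i)     = twist-spoke offset (r * toℕ i + k)
    act-edge (twist k)  (hub i j p)   = twist-hub offset (twist-shift a k (≡%⇒≈ p))
    act-edge (twist k)  (inner i j p) = inj₁ (rim′ (twist-inner k (≡%⇒≈ p)))

    act-adj : ∀ w {u v} → RAdj n a r u v → RAdj n a r (act w u) (act w v)
    act-adj w (inj₁ e) = act-edge w e
    act-adj w (inj₂ e) = swap (act-edge w e)

    rd≈d : r * d ≈ d
    rd≈d = twistOffset⇒rd≈d offset

    automorphism : Word → Automorphism (RAdj n a r)
    automorphism w = record
      { fun       = act w
      ; inv       = act (w ⁻¹)
      ; inv-left  = act-inverseˡ r²≈1 rd≈d w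
      ; inv-right = act-inverseʳ r²≈1 rd≈d w
      ; preserves = λ _ _ → act-adj w
      ; reflects  = λ u v e → subst₂ (RAdj n a r) (act-inverseˡ r²≈1 rd≈d w u) (act-inverseˡ r²≈1 rd≈d w v)
                                     (act-adj (w ⁻¹) e)
      }

    RotationsAndTwists : Automorphism (RAdj n a r) → Set
    RotationsAndTwists g = Σ Word λ w → ∀ v → fun g v ≡ act w v

    rotationsAndTwists-isSubgroup : IsSubgroup RotationsAndTwists
    rotationsAndTwists-isSubgroup = record
      { has-id   = automorphism (rotate 0) , (rotate 0 , λ _ → refl) , act-rotate-0
      ; has-comp = λ { g h (w , g≗w) (w′ , h≗w′) →
          automorphism (w · w′) , (w · w′ , λ _ → refl) ,
          λ v → sym (trans (g≗w (fun h v)) (trans (cong (act w) (h≗w′ v)) (act-· r²≈1 rd≈d w w′ v))) }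
      ; has-inv  = λ { g (w , g≗w) →
          automorphism (w ⁻¹) , (w ⁻¹ , λ _ → refl) ,
          λ v → trans (cong (act (w ⁻¹)) (trans (sym (inv-right g v)) (g≗w (inv g v))))
                      (act-inverseˡ r²≈1 rd≈d w (inv g v)) }
      }

    rotationsAndTwists-isRegular : IsRegular RotationsAndTwists
    rotationsAndTwists-isRegular = reach , unique
      where
      reach : ∀ u v → Σ (Automorphism (RAdj n a r)) λ g → RotationsAndTwists g × (fun g u ≡ v)
      reach u v with act-transitive u v
      ... | w , wu≡v = automorphism w , (w , λ _ → refl) , wu≡v

      unique : ∀ u v g h → RotationsAndTwists g → RotationsAndTwists h →
               fun g u ≡ v → fun h u ≡ v → ∀ x → fun g x ≡ fun h x
      unique u v g h (w , g≗w) (w′ , h≗w′) gu≡v hu≡v x =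
        trans (g≗w x) (trans (act-cong w≃w′ x) (sym (h≗w′ x)))
        where
        w≃w′ : w ≃ w′
        w≃w′ = act-free w w′ u (trans (sym (g≗w u)) (trans gu≡v (trans (sym hu≡v) (h≗w′ u))))

    rotationsAndTwists-isCayley : IsCayley (RAdj n a r)
    rotationsAndTwists-isCayley =
      RotationsAndTwists , rotationsAndTwists-isSubgroup , rotationsAndTwists-isRegular

mainTheorem2 : (n a r : ℕ) .{{_ : NonZero n}} → 3 ≤ n →
    1 ≤ a → a < n → 1 ≤ r → r < n →
    (r * r) % n ≡ 1 % n →
    ((r * a) % n ≡ a % n ⊎ (r * a + a) % n ≡ 0) →
    IsCayley (RAdj n a r)
mainTheorem2 n a r _ _ _ _ _ r²≡1 (inj₁ ra≡a) =
  RoseWindow.rotationsAndTwists-isCayley n a r a (mod-eq r²≡1) (inj₁ (≈-refl , mod-eq ra≡a))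
  where open Modular n
mainTheorem2 n a r _ _ _ _ _ r²≡1 (inj₂ ra+a≡0) =
  RoseWindow.rotationsAndTwists-isCayley n a r 0 (mod-eq r²≡1) (inj₂ (≈-refl , mod-eq (trans ra+a≡0 (sym 0%n≡0))))
  where open Modular n
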